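{- Let $p$ be a prime. (1) If $p>3$ and $\iota(p)<\rho(p)$, then none of $p^2,p^3,p^4,\ldots$ is a Salajan value. (2) If $\iota(p)\le p/2$, then none of $p,p^2,p^3,\ldots$ is a Salajan value.
   Context: The Salajan sequence is $u_1,u_2,\ldots$ with $u_j=(3^j-5(-1)^j)/4$ for $j\ge1$; its terms are distinct. For $n\ge1$, $D_S(n)$ is the smallest positive integer $m$ such that $u_1,\ldots,u_n$ are pairwise incongruent modulo $m$; a positive integer $m$ is a Salajan value if $m=D_S(n)$ for some $n\ge1$. For a prime $p>3$ the sequence is purely periodic modulo $p$ and $\rho(p)$ denotes its period, the smallest $k\ge1$ with $u_n\equiv u_{n+k}\pmod p$ for all $n\ge1$. For a positive integer $N$, $\iota(N)$ is the largest integer $k$ such that $u_1,\ldots,u_k$ are pairwise incongruent modulo $N$. -}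

module Defs where

open import Data.Nat using (ℕ; zero; suc; _≤_; _<_)
open import Data.Integer as ℤ using (ℤ; +_; -[1+_]; _-_; _*_; _^_)
open import Data.Integer.Divisibility using (_∣_)
open import Data.Integer.DivMod using (_/_)
open import Data.Product using (_×_; Σ)
open import Relation.Nullary using (¬_)

-- u j = (3^j - 5 (-1)^j) / 4  (exact integer division; numerator is divisible by 4)
u : ℕ → ℤ
u j = ((+ 3) ^ j - (+ 5) * (-[1+ 0 ] ^ j)) / (+ 4)

Congr : ℕ → ℤ → ℤ → Set
Congr m a b = (+ m) ∣ (a - b)

Incong : ℕ → ℕ → Set
Incong m n = ∀ i j → 1 ≤ i → i < j → j ≤ n → ¬ Congr m (u i) (u j)

IsDS : ℕ → ℕ → Set
IsDS n m = (1 ≤ m) × Incong m n × (∀ m′ → 1 ≤ m′ → m′ < m → ¬ Incong m′ n)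

SalajanValue : ℕ → Set
SalajanValue m = Σ ℕ λ n → (1 ≤ n) × IsDS n m

IsPeriod : ℕ → ℕ → Set
IsPeriod p k = ∀ n → 1 ≤ n → Congr p (u n) (u (n Data.Nat.+ k))

IsRho : ℕ → ℕ → Set
IsRho p r = (1 ≤ r) × IsPeriod p r × (∀ k → 1 ≤ k → k < r → ¬ IsPeriod p k)

IsIota : ℕ → ℕ → Set
IsIota N k = Incong N k × (∀ k′ → k < k′ → ¬ Incong N k′)

module Submission where

-- Write p^e = pP. If p^e = D_S(n) then p^e < 2n: u_1, …, u_{2^k} are pairwise incongruent modulo 2^k
-- (u_{j+2^k} − u_j is 2^k times an odd number), so no power of two below p^e may reach n. Modulo a
-- prime p > 3 the sequence has a period R < p, as 3^{2d} ≡ 1 (mod p) for some d ≤ (p − 1)/2. Terms in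
-- c residue classes modulo p that are pairwise incongruent modulo pP number at most cP. The first
-- repetition u_a ≡ u_{ι(p)+1} (mod p) lies within a period R when ι(p) < R (take R = ρ(p) in (1));
-- then the progressions a + tR and ι(p) + 1 + tR put more than P of u_1, …, u_n into one class.
-- Otherwise R ≤ ι(p) ≤ p/2 and R classes would hold all n > pP/2 ≥ RP terms. Finally p^1 fails in
-- (2) since n ≤ ι(p) ≤ p/2.

open import Defs
open import Data.Empty using (⊥)
open import Data.Fin using (Fin; toℕ; fromℕ<; remQuot; combine)
open import Data.Fin.Patterns using (0F; 1F)
import Data.Fin.Properties as Fin
open import Data.Nat.Primality using (Prime; euclidsLemma; ¬prime[1]; composite; prime⇒nonTrivial)
open import Data.Product using (_×_; ∃-syntax; _,_; uncurry)
open import Data.Sum using (_⊎_; inj₁; inj₂)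
open import Function using (_∘_; case_of_)
open import Relation.Binary.PropositionalEquality
open import Relation.Binary.Definitions using (tri<; tri≈; tri>)
open import Relation.Nullary using (¬_; contradiction; yes; no)

module Congruences where

  open import Data.Integer
  open import Data.Integer.Properties
  open import Data.Integer.Divisibility.Signed
  open import Data.Integer.DivMod using (a≡a%ℕn+[a/ℕn]*n; n%ℕd<d)
  open import Data.Integer.Tactic.RingSolver using (solve-∀)
  import Data.Nat as ℕ
  import Data.Nat.Properties as ℕ
  import Data.Nat.DivMod as ℕ
  import Data.Nat.Divisibility as ℕ

  Congr-refl : ∀ m a → Congr m a a
  Congr-refl m a rewrite +-inverseʳ a = m ℕ.∣0

  Congr-sym : ∀ m a b → Congr m a b → Congr m b a
  Congr-sym m a b = subst (m ℕ.∣_) (∣i-j∣≡∣j-i∣ a b)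

  Congr-trans : ∀ m a b c → Congr m a b → Congr m b c → Congr m a c
  Congr-trans m a b c ab bc = ∣⇒∣ᵤ (subst (+ m ∣_) (telescope a b c)
    (∣m∣n⇒∣m+n (∣ᵤ⇒∣ {i = a - b} ab) (∣ᵤ⇒∣ {i = b - c} bc)))
    where
    telescope : ∀ a b c → (a - b) + (b - c) ≡ a - c
    telescope = solve-∀

  Congr-weaken : ∀ {m n} a b → m ℕ.∣ n → Congr n a b → Congr m a b
  Congr-weaken _ _ = ℕ.∣-trans

  pos-^ : ∀ m n → + (m ℕ.^ n) ≡ (+ m) ^ n
  pos-^ m ℕ.zero    = refl
  pos-^ m (ℕ.suc n) = trans (pos-* m (m ℕ.^ n)) (cong (+ m *_) (pos-^ m n))

  ^-double : ∀ i n → i ^ (2 ℕ.* n) ≡ i ^ n * i ^ n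
  ^-double i n = trans (^-distribˡ-+-* i n (n ℕ.+ 0)) (cong ((i ^ n *_) ∘ (i ^_)) (ℕ.+-identityʳ n))

  [i*n]/ℕn≡i : ∀ i n .{{_ : ℕ.NonZero n}} → (i * + n) /ℕ n ≡ i
  [i*n]/ℕn≡i (+ m) n rewrite sym (pos-* m n) = cong +_ (ℕ.m*n/n≡m m n)
  [i*n]/ℕn≡i -[1+ m ] n@(ℕ.suc _) with ℕ.suc m ℕ.* n ℕ.% n in eq
  ... | ℕ.zero  = cong (-_ ∘ +_) (ℕ.m*n/n≡m (ℕ.suc m) n)
  ... | ℕ.suc _ with () ← trans (sym eq) (ℕ.m*n%n≡0 (ℕ.suc m) n)

  [i*n]/n≡i : ∀ i n .{{_ : ℕ.NonZero n}} → (i * + n) / + n ≡ i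
  [i*n]/n≡i i n = trans (*-identityˡ _) ([i*n]/ℕn≡i i n)

  Odd : ℤ → Set
  Odd x = ∃[ c ] x ≡ + 2 * c + 1ℤ

  odd-* : ∀ {x y} → Odd x → Odd y → Odd (x * y)
  odd-* (a , refl) (b , refl) = + 2 * a * b + a + b , expand a b
    where
    expand : ∀ a b → (+ 2 * a + 1ℤ) * (+ 2 * b + 1ℤ) ≡ + 2 * (+ 2 * a * b + a + b) + 1ℤ
    expand = solve-∀

  odd-^ : ∀ {x} n → Odd x → Odd (x ^ n)
  odd-^ ℕ.zero    _  = 0ℤ , refl
  odd-^ (ℕ.suc n) ox = odd-* ox (odd-^ n ox)

  odd⇒2∤ : ∀ {x} → Odd x → ¬ (+ 2 ∣ x)
  odd⇒2∤ (c , refl) 2∣x with ℕ.∣1⇒≡1 (∣⇒∣ᵤ (∣m+n∣m⇒∣n 2∣x (∣m⇒∣m*n c ∣-refl)))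
  ... | ()

  numerator : ℕ.ℕ → ℤ
  numerator j = (+ 3) ^ j - + 5 * -1ℤ ^ j

  numerator-step : ∀ {k} j → k * + 4 ≡ numerator j →
                   (+ 3 * k + + 5 * -1ℤ ^ j) * + 4 ≡ numerator (ℕ.suc j)
  numerator-step {k} j eq = begin
    (+ 3 * k + + 5 * s) * + 4      ≡⟨ distrib k s ⟩
    + 3 * (k * + 4) + + 20 * s     ≡⟨ cong (λ t → + 3 * t + + 20 * s) eq ⟩
    + 3 * numerator j + + 20 * s   ≡⟨ regroup ((+ 3) ^ j) s ⟩
    numerator (ℕ.suc j)            ∎
    where
    open ≡-Reasoning
    s = -1ℤ ^ j
    distrib : ∀ k s → (+ 3 * k + + 5 * s) * + 4 ≡ + 3 * (k * + 4) + + 20 * s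
    distrib = solve-∀
    regroup : ∀ t s → + 3 * (t - + 5 * s) + + 20 * s ≡ + 3 * t - + 5 * (-1ℤ * s)
    regroup = solve-∀

  4∣numerator : ∀ j → + 4 ∣ numerator j
  4∣numerator ℕ.zero    = divides -1ℤ refl
  4∣numerator (ℕ.suc j) with 4∣numerator j
  ... | divides k eq = divides (+ 3 * k + + 5 * -1ℤ ^ j) (sym (numerator-step {k} j (sym eq)))

  u*4≡numerator : ∀ j → u j * + 4 ≡ numerator j
  u*4≡numerator j with 4∣numerator j
  ... | divides k eq = begin
    numerator j / + 4 * + 4   ≡⟨ cong (λ t → t / + 4 * + 4) eq ⟩
    k * + 4 / + 4 * + 4       ≡⟨ cong (_* + 4) ([i*n]/n≡i k 4) ⟩
    k * + 4                   ≡⟨ eq ⟨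
    numerator j               ∎
    where open ≡-Reasoning

  u-suc : ∀ j → u (ℕ.suc j) ≡ + 3 * u j + + 5 * -1ℤ ^ j
  u-suc j = *-cancelʳ-≡ _ _ (+ 4)
    (trans (u*4≡numerator (ℕ.suc j)) (sym (numerator-step {u j} j (u*4≡numerator j))))

  [-1]^2d≡1 : ∀ d → -1ℤ ^ (2 ℕ.* d) ≡ 1ℤ
  [-1]^2d≡1 d = trans (sym (^-*-assoc -1ℤ 2 d)) (^-zeroˡ d)

  [u[j+2d]-u[j]]*4≡3^j[3^2d-1] : ∀ j d →
    (u (j ℕ.+ 2 ℕ.* d) - u j) * + 4 ≡ (+ 3) ^ j * ((+ 3) ^ (2 ℕ.* d) - 1ℤ)
  [u[j+2d]-u[j]]*4≡3^j[3^2d-1] j d = begin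
    (u (j ℕ.+ 2 ℕ.* d) - u j) * + 4
      ≡⟨ distrib (u (j ℕ.+ 2 ℕ.* d)) (u j) ⟩
    u (j ℕ.+ 2 ℕ.* d) * + 4 - u j * + 4
      ≡⟨ cong₂ _-_ (u*4≡numerator (j ℕ.+ 2 ℕ.* d)) (u*4≡numerator j) ⟩
    numerator (j ℕ.+ 2 ℕ.* d) - numerator j
      ≡⟨ cong₂ (λ a b → a - + 5 * b - numerator j) (^-distribˡ-+-* (+ 3) j (2 ℕ.* d)) [-1]^[j+2d]≡[-1]^j ⟩
    (+ 3) ^ j * (+ 3) ^ (2 ℕ.* d) - + 5 * (-1ℤ ^ j * 1ℤ) - numerator j
      ≡⟨ cancel ((+ 3) ^ j) ((+ 3) ^ (2 ℕ.* d)) (-1ℤ ^ j) ⟩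
    (+ 3) ^ j * ((+ 3) ^ (2 ℕ.* d) - 1ℤ)
      ∎
    where
    open ≡-Reasoning
    [-1]^[j+2d]≡[-1]^j : -1ℤ ^ (j ℕ.+ 2 ℕ.* d) ≡ -1ℤ ^ j * 1ℤ
    [-1]^[j+2d]≡[-1]^j = trans (^-distribˡ-+-* -1ℤ j (2 ℕ.* d)) (cong (-1ℤ ^ j *_) ([-1]^2d≡1 d))
    distrib : ∀ a b → (a - b) * + 4 ≡ a * + 4 - b * + 4
    distrib = solve-∀
    cancel : ∀ t t′ s → t * t′ - + 5 * (s * 1ℤ) - (t - + 5 * s) ≡ t * (t′ - 1ℤ)
    cancel = solve-∀

  3^2^[1+k]-1≡2^[3+k]*odd : ∀ k → ∃[ o ] Odd o × (+ 3) ^ (2 ℕ.^ ℕ.suc k) - 1ℤ ≡ (+ 2) ^ (3 ℕ.+ k) * o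
  3^2^[1+k]-1≡2^[3+k]*odd ℕ.zero    = 1ℤ , (0ℤ , refl) , refl
  3^2^[1+k]-1≡2^[3+k]*odd (ℕ.suc k) with 3^2^[1+k]-1≡2^[3+k]*odd k
  ... | o , odd-o , eq = o * (+ 4 * Q * o + 1ℤ) , odd-* odd-o (+ 2 * Q * o , four Q o) , (begin
    (+ 3) ^ (2 ℕ.* X) - 1ℤ                                 ≡⟨ cong (_- 1ℤ) (^-double (+ 3) X) ⟩
    (+ 3) ^ X * (+ 3) ^ X - 1ℤ                             ≡⟨ difference-of-squares ((+ 3) ^ X) ⟩
    ((+ 3) ^ X - 1ℤ) * ((+ 3) ^ X - 1ℤ + + 2)              ≡⟨ cong (λ t → t * (t + + 2)) eq ⟩
    (+ 2) ^ (3 ℕ.+ k) * o * ((+ 2) ^ (3 ℕ.+ k) * o + + 2)  ≡⟨ expand Q o ⟩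
    (+ 2) ^ (3 ℕ.+ ℕ.suc k) * (o * (+ 4 * Q * o + 1ℤ))     ∎)
    where
    open ≡-Reasoning
    X = 2 ℕ.^ ℕ.suc k
    Q = (+ 2) ^ k
    four : ∀ Q o → + 4 * Q * o + 1ℤ ≡ + 2 * (+ 2 * Q * o) + 1ℤ
    four = solve-∀
    difference-of-squares : ∀ t → t * t - 1ℤ ≡ (t - 1ℤ) * (t - 1ℤ + + 2)
    difference-of-squares = solve-∀
    expand : ∀ Q o → + 2 * (+ 2 * (+ 2 * Q)) * o * (+ 2 * (+ 2 * (+ 2 * Q)) * o + + 2)
                   ≡ + 2 * (+ 2 * (+ 2 * (+ 2 * Q))) * (o * (+ 4 * Q * o + 1ℤ))
    expand = solve-∀

  u[j+2^k]-u[j]≡2^k*odd : ∀ k j → ∃[ o ] Odd o × u (j ℕ.+ 2 ℕ.^ k) - u j ≡ (+ 2) ^ k * o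
  u[j+2^k]-u[j]≡2^k*odd ℕ.zero j with odd-^ j (-1ℤ , refl)
  ... | c , [-1]^j≡2c+1 rewrite ℕ.+-comm j 1 =
    u (ℕ.suc j) - u j , (u j + + 5 * c + + 2 , u[1+j]-u[j]≡2c′+1) , sym (*-identityˡ _)
    where
    open ≡-Reasoning
    collect : ∀ t c → + 3 * t + + 5 * (+ 2 * c + 1ℤ) - t ≡ + 2 * (t + + 5 * c + + 2) + 1ℤ
    collect = solve-∀
    u[1+j]-u[j]≡2c′+1 : u (ℕ.suc j) - u j ≡ + 2 * (u j + + 5 * c + + 2) + 1ℤ
    u[1+j]-u[j]≡2c′+1 = begin
      u (ℕ.suc j) - u j                       ≡⟨ cong (_- u j) (u-suc j) ⟩
      + 3 * u j + + 5 * -1ℤ ^ j - u j         ≡⟨ cong (λ s → + 3 * u j + + 5 * s - u j) [-1]^j≡2c+1 ⟩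
      + 3 * u j + + 5 * (+ 2 * c + 1ℤ) - u j  ≡⟨ collect (u j) c ⟩
      + 2 * (u j + + 5 * c + + 2) + 1ℤ        ∎
  u[j+2^k]-u[j]≡2^k*odd (ℕ.suc k) j with 3^2^[1+k]-1≡2^[3+k]*odd k
  ... | o , odd-o , eq = (+ 3) ^ j * o , odd-* (odd-^ j (1ℤ , refl)) odd-o ,
    *-cancelʳ-≡ _ _ (+ 4) (begin
      (u (j ℕ.+ 2 ℕ.* 2 ℕ.^ k) - u j) * + 4      ≡⟨ [u[j+2d]-u[j]]*4≡3^j[3^2d-1] j (2 ℕ.^ k) ⟩
      (+ 3) ^ j * ((+ 3) ^ (2 ℕ.^ ℕ.suc k) - 1ℤ)  ≡⟨ cong ((+ 3) ^ j *_) eq ⟩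
      (+ 3) ^ j * ((+ 2) ^ (3 ℕ.+ k) * o)         ≡⟨ regroup ((+ 3) ^ j) ((+ 2) ^ k) o ⟩
      (+ 2) ^ ℕ.suc k * ((+ 3) ^ j * o) * + 4     ∎)
    where
    open ≡-Reasoning
    regroup : ∀ t Q o → t * (+ 2 * (+ 2 * (+ 2 * Q)) * o) ≡ + 2 * Q * (t * o) * + 4
    regroup = solve-∀

  u[j+2^k]≡u[j][mod2^k] : ∀ k j → Congr (2 ℕ.^ k) (u (j ℕ.+ 2 ℕ.^ k)) (u j)
  u[j+2^k]≡u[j][mod2^k] k j with u[j+2^k]-u[j]≡2^k*odd k j
  ... | o , _ , eq = ∣⇒∣ᵤ (divides o (begin
    u (j ℕ.+ 2 ℕ.^ k) - u j   ≡⟨ eq ⟩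
    (+ 2) ^ k * o             ≡⟨ *-comm ((+ 2) ^ k) o ⟩
    o * (+ 2) ^ k             ≡⟨ cong (o *_) (pos-^ 2 k) ⟨
    o * + (2 ℕ.^ k)           ∎))
    where open ≡-Reasoning

  u[j+2^k]≢u[j][mod2^[1+k]] : ∀ k j → ¬ Congr (2 ℕ.^ ℕ.suc k) (u (j ℕ.+ 2 ℕ.^ k)) (u j)
  u[j+2^k]≢u[j][mod2^[1+k]] k j c with u[j+2^k]-u[j]≡2^k*odd k j
  ... | o , odd-o , eq = odd⇒2∤ odd-o (*-cancelˡ-∣ ((+ 2) ^ k) {{2^k≢0}} 2^k*2∣2^k*o)
    where
    2^k≢0 : NonZero ((+ 2) ^ k)
    2^k≢0 = subst NonZero (pos-^ 2 k) (ℕ.m^n≢0 2 k)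
    2^k*2∣2^k*o : (+ 2) ^ k * + 2 ∣ (+ 2) ^ k * o
    2^k*2∣2^k*o = subst₂ _∣_ (trans (pos-^ 2 (ℕ.suc k)) (*-comm (+ 2) ((+ 2) ^ k))) eq (∣ᵤ⇒∣ c)

  odd-prime : ∀ {p} → Prime p → 2 ℕ.< p → ∃[ h ] p ≡ ℕ.suc (2 ℕ.* h)
  odd-prime {p} pp 2<p with p ℕ.% 2 in eq | ℕ.m%n<n p 2
  ... | 0 | _ = contradiction (composite 2<p (ℕ.m%n≡0⇒n∣m p 2 eq)) (Prime.notComposite pp)
  ... | 1 | _ = p ℕ./ 2 , trans (ℕ.m≡m%n+[m/n]*n p 2) (cong₂ ℕ._+_ eq (ℕ.*-comm (p ℕ./ 2) 2))
  ... | ℕ.suc (ℕ.suc _) | ℕ.s≤s (ℕ.s≤s ())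

  prime∤c^n : ∀ {p c} → Prime p → ¬ p ℕ.∣ c → ∀ n → ¬ p ℕ.∣ c ℕ.^ n
  prime∤c^n pp _   ℕ.zero    p∣1 = ¬prime[1] (subst Prime (ℕ.∣1⇒≡1 p∣1) pp)
  prime∤c^n pp p∤c (ℕ.suc n) p∣c*cⁿ with euclidsLemma _ _ pp p∣c*cⁿ
  ... | inj₁ p∣c  = p∤c p∣c
  ... | inj₂ p∣cⁿ = prime∤c^n pp p∤c n p∣cⁿ

  prime-∣*⇒∣ : ∀ {p} c {y} → Prime p → ¬ p ℕ.∣ ∣ c ∣ → + p ∣ c * y → + p ∣ y
  prime-∣*⇒∣ c {y} pp p∤c p∣cy
    with euclidsLemma ∣ c ∣ ∣ y ∣ pp (subst (_ ℕ.∣_) (abs-* c y) (∣⇒∣ᵤ p∣cy))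
  ... | inj₁ p∣c = contradiction p∣c p∤c
  ... | inj₂ p∣y = ∣ᵤ⇒∣ p∣y

  3^2d≡1⇒IsPeriod : ∀ {p} d → Prime p → 2 ℕ.< p → + p ∣ (+ 3) ^ (2 ℕ.* d) - 1ℤ → IsPeriod p (2 ℕ.* d)
  3^2d≡1⇒IsPeriod {p} d pp 2<p p∣3^2d-1 n _ = Congr-sym p (u (n ℕ.+ 2 ℕ.* d)) (u n)
    (∣⇒∣ᵤ (prime-∣*⇒∣ (+ 4) pp (prime∤c^n pp (ℕ.>⇒∤ 2<p) 2) p∣4[u[n+2d]-u[n]]))
    where
    p∣4[u[n+2d]-u[n]] : + p ∣ + 4 * (u (n ℕ.+ 2 ℕ.* d) - u n)
    p∣4[u[n+2d]-u[n]] = subst (+ p ∣_) (trans (sym ([u[j+2d]-u[j]]*4≡3^j[3^2d-1] n d)) (*-comm _ (+ 4)))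
      (∣n⇒∣m*n ((+ 3) ^ n) p∣3^2d-1)

  ∣x-x%ℕp : ∀ p .{{_ : ℕ.NonZero p}} x → + p ∣ x - + (x %ℕ p)
  ∣x-x%ℕp p x = divides (x /ℕ p) (begin
    x - + (x %ℕ p)                          ≡⟨ cong (_- + (x %ℕ p)) (a≡a%ℕn+[a/ℕn]*n x p) ⟩
    + (x %ℕ p) + x /ℕ p * + p - + (x %ℕ p)  ≡⟨ cancel (+ (x %ℕ p)) (x /ℕ p * + p) ⟩
    x /ℕ p * + p                            ∎)
    where
    open ≡-Reasoning
    cancel : ∀ r t → r + t - r ≡ t
    cancel = solve-∀

  %ℕ≡⇒∣- : ∀ p .{{_ : ℕ.NonZero p}} x y → x %ℕ p ≡ y %ℕ p → + p ∣ x - y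
  %ℕ≡⇒∣- p x y eq = subst (+ p ∣_)
    (trans (cong (λ r → (x - + (x %ℕ p)) - (y - + r)) (sym eq)) (cancel x y (+ (x %ℕ p))))
    (∣m∣n⇒∣m-n (∣x-x%ℕp p x) (∣x-x%ℕp p y))
    where
    cancel : ∀ x y r → (x - r) - (y - r) ≡ x - y
    cancel = solve-∀

  %ℕ+%ℕ≡p⇒∣+ : ∀ p .{{_ : ℕ.NonZero p}} x y → x %ℕ p ℕ.+ y %ℕ p ≡ p → + p ∣ x + y
  %ℕ+%ℕ≡p⇒∣+ p x y eq = subst (+ p ∣_) (cancel x y (+ (x %ℕ p)) (+ (y %ℕ p)))
    (∣m∣n⇒∣m+n (∣m∣n⇒∣m+n (∣x-x%ℕp p x) (∣x-x%ℕp p y)) p∣rx+ry)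
    where
    p∣rx+ry : + p ∣ + (x %ℕ p) + + (y %ℕ p)
    p∣rx+ry = subst (+ p ∣_) (trans (cong +_ (sym eq)) (pos-+ (x %ℕ p) (y %ℕ p))) ∣-refl
    cancel : ∀ x y r r′ → (x - r) + (y - r′) + (r + r′) ≡ x + y
    cancel = solve-∀

  ∤⇒%ℕ≢0 : ∀ p .{{_ : ℕ.NonZero p}} x → ¬ + p ∣ x → 1 ℕ.≤ x %ℕ p
  ∤⇒%ℕ≢0 p x p∤x with x %ℕ p in eq
  ... | ℕ.suc _ = ℕ.s≤s ℕ.z≤n
  ... | ℕ.zero  = contradiction
    (subst (+ p ∣_) (+-identityʳ x) (subst (λ r → + p ∣ x - + r) eq (∣x-x%ℕp p x))) p∤x

  abs-residue : ∀ p .{{_ : ℕ.NonZero p}} → ℤ → ℕ.ℕ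
  abs-residue p x = x %ℕ p ℕ.⊓ (p ℕ.∸ x %ℕ p)

  abs-residue-≡ : ∀ p .{{_ : ℕ.NonZero p}} x y → abs-residue p x ≡ abs-residue p y →
                  (+ p ∣ x - y) ⊎ (+ p ∣ x + y)
  abs-residue-≡ p x y eq with ℕ.⊓-sel (x %ℕ p) (p ℕ.∸ x %ℕ p) | ℕ.⊓-sel (y %ℕ p) (p ℕ.∸ y %ℕ p)
  ... | inj₁ ex | inj₁ ey = inj₁ (%ℕ≡⇒∣- p x y (trans (sym ex) (trans eq ey)))
  ... | inj₁ ex | inj₂ ey = inj₂ (%ℕ+%ℕ≡p⇒∣+ p x y
    (trans (cong (ℕ._+ y %ℕ p) (trans (sym ex) (trans eq ey))) (ℕ.m∸n+n≡m (ℕ.<⇒≤ (n%ℕd<d y p)))))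
  ... | inj₂ ex | inj₁ ey = inj₂ (%ℕ+%ℕ≡p⇒∣+ p x y
    (trans (cong (x %ℕ p ℕ.+_) (trans (sym ey) (trans (sym eq) ex))) (ℕ.m+[n∸m]≡n (ℕ.<⇒≤ (n%ℕd<d x p)))))
  ... | inj₂ ex | inj₂ ey = inj₁ (%ℕ≡⇒∣- p x y
    (ℕ.∸-cancelˡ-≡ (ℕ.<⇒≤ (n%ℕd<d x p)) (ℕ.<⇒≤ (n%ℕd<d y p)) (trans (sym ex) (trans eq ey))))

  abs-residue-positive : ∀ p .{{_ : ℕ.NonZero p}} x → ¬ + p ∣ x → 1 ℕ.≤ abs-residue p x
  abs-residue-positive p x p∤x = ℕ.⊓-glb (∤⇒%ℕ≢0 p x p∤x) (ℕ.m<n⇒0<n∸m (n%ℕd<d x p))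

  abs-residue-half : ∀ p .{{_ : ℕ.NonZero p}} x → 2 ℕ.* abs-residue p x ℕ.≤ p
  abs-residue-half p x = begin
    2 ℕ.* abs-residue p x                ≡⟨ cong (abs-residue p x ℕ.+_) (ℕ.+-identityʳ _) ⟩
    abs-residue p x ℕ.+ abs-residue p x
      ≤⟨ ℕ.+-mono-≤ (ℕ.m⊓n≤m r (p ℕ.∸ r)) (ℕ.m⊓n≤n r (p ℕ.∸ r)) ⟩
    r ℕ.+ (p ℕ.∸ r)                      ≡⟨ ℕ.m+[n∸m]≡n (ℕ.<⇒≤ (n%ℕd<d x p)) ⟩
    p                                    ∎
    where
    open ℕ.≤-Reasoning
    r = x %ℕ p

  2m≤1+2n⇒m≤n : ∀ {m n} → 2 ℕ.* m ℕ.≤ ℕ.suc (2 ℕ.* n) → m ℕ.≤ n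
  2m≤1+2n⇒m≤n {m} {n} le = ℕ.s≤s⁻¹ (ℕ.*-cancelˡ-< 2 m (ℕ.suc n)
    (ℕ.≤-<-trans le (subst (ℕ.suc (2 ℕ.* n) ℕ.<_) (sym (ℕ.*-suc 2 n)) (ℕ.n<1+n _))))

  ∣1∓t⇒∣t*t-1 : ∀ {m t} → (m ∣ 1ℤ - t) ⊎ (m ∣ 1ℤ + t) → m ∣ t * t - 1ℤ
  ∣1∓t⇒∣t*t-1 {t = t} (inj₁ m∣1-t) = subst (_ ∣_) (factor t) (∣m⇒∣m*n (- t - 1ℤ) m∣1-t)
    where
    factor : ∀ t → (1ℤ - t) * (- t - 1ℤ) ≡ t * t - 1ℤ
    factor = solve-∀
  ∣1∓t⇒∣t*t-1 {t = t} (inj₂ m∣1+t) = subst (_ ∣_) (factor t) (∣m⇒∣m*n (t - 1ℤ) m∣1+t)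
    where
    factor : ∀ t → (1ℤ + t) * (t - 1ℤ) ≡ t * t - 1ℤ
    factor = solve-∀

  -- Pigeonhole on the abs-residues of 3^0, …, 3^h, where p = 2h + 1, gives 3^a ≡ ±3^b with a < b ≤ h.
  3^2d≡1-for-small-d : ∀ {p} → Prime p → 3 ℕ.< p →
                       ∃[ d ] 1 ℕ.≤ d × 2 ℕ.* d ℕ.< p × + p ∣ (+ 3) ^ (2 ℕ.* d) - 1ℤ
  3^2d≡1-for-small-d {p} pp 3<p with odd-prime pp (ℕ.<-trans (ℕ.n<1+n 2) 3<p)
  ... | h , refl = from-collision (Fin.pigeonhole (ℕ.n<1+n h) code)
    where
    residue : ℕ.ℕ → ℕ.ℕ
    residue i = abs-residue p ((+ 3) ^ i)
    p∤3^i : ∀ i → ¬ + p ∣ (+ 3) ^ i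
    p∤3^i i p∣3^i =
      prime∤c^n pp (ℕ.>⇒∤ 3<p) i (subst (p ℕ.∣_) (cong ∣_∣ (sym (pos-^ 3 i))) (∣⇒∣ᵤ p∣3^i))
    1≤residue : ∀ i → 1 ℕ.≤ residue i
    1≤residue i = abs-residue-positive p _ (p∤3^i i)
    residue∸1<h : ∀ i → residue i ℕ.∸ 1 ℕ.< h
    residue∸1<h i with residue i | 1≤residue i | 2m≤1+2n⇒m≤n {residue i} (abs-residue-half p ((+ 3) ^ i))
    ... | ℕ.suc r | _ | r<h = r<h
    code : Fin (ℕ.suc h) → Fin h
    code i = fromℕ< (residue∸1<h (toℕ i))
    from-collision : (∃[ i ] ∃[ j ] i Data.Fin.< j × code i ≡ code j) →
                     ∃[ d ] 1 ℕ.≤ d × 2 ℕ.* d ℕ.< p × + p ∣ (+ 3) ^ (2 ℕ.* d) - 1ℤ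
    from-collision (i , j , a<b , code-eq) = d , ℕ.m<n⇒0<n∸m a<b , 2d<p ,
      subst (+ p ∣_) (cong (_- 1ℤ) (sym (^-double (+ 3) d))) (∣1∓t⇒∣t*t-1 {t = (+ 3) ^ d} p∣1∓3^d)
      where
      open ≡-Reasoning
      a = toℕ i
      b = toℕ j
      d = b ℕ.∸ a
      2d<p : 2 ℕ.* d ℕ.< ℕ.suc (2 ℕ.* h)
      2d<p = ℕ.s≤s (ℕ.*-monoʳ-≤ 2 (ℕ.≤-trans (ℕ.m∸n≤m b a) (ℕ.s≤s⁻¹ (Fin.toℕ<n j))))
      3^b≡3^a*3^d : (+ 3) ^ b ≡ (+ 3) ^ a * (+ 3) ^ d
      3^b≡3^a*3^d = trans (cong ((+ 3) ^_) (sym (ℕ.m+[n∸m]≡n (ℕ.<⇒≤ a<b)))) (^-distribˡ-+-* (+ 3) a d)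
      residue-eq : residue a ≡ residue b
      residue-eq = ℕ.∸-cancelʳ-≡ (1≤residue a) (1≤residue b)
        (trans (sym (Fin.toℕ-fromℕ< _)) (trans (cong toℕ code-eq) (Fin.toℕ-fromℕ< _)))
      cancel-3^a : ∀ {t} → + p ∣ (+ 3) ^ a * t → + p ∣ t
      cancel-3^a = prime-∣*⇒∣ ((+ 3) ^ a) pp (p∤3^i a ∘ ∣ᵤ⇒∣)
      p∣1∓3^d : (+ p ∣ 1ℤ - (+ 3) ^ d) ⊎ (+ p ∣ 1ℤ + (+ 3) ^ d)
      p∣1∓3^d with abs-residue-≡ p ((+ 3) ^ a) ((+ 3) ^ b) residue-eq
      ... | inj₁ p∣3^a-3^b = inj₁ (cancel-3^a (subst (+ p ∣_) (begin
        (+ 3) ^ a - (+ 3) ^ b              ≡⟨ cong (λ t → (+ 3) ^ a - t) 3^b≡3^a*3^d ⟩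
        (+ 3) ^ a - (+ 3) ^ a * (+ 3) ^ d  ≡⟨ factor ((+ 3) ^ a) ((+ 3) ^ d) ⟩
        (+ 3) ^ a * (1ℤ - (+ 3) ^ d)       ∎) p∣3^a-3^b))
        where
        factor : ∀ x t → x - x * t ≡ x * (1ℤ - t)
        factor = solve-∀
      ... | inj₂ p∣3^a+3^b = inj₂ (cancel-3^a (subst (+ p ∣_) (begin
        (+ 3) ^ a + (+ 3) ^ b              ≡⟨ cong (λ t → (+ 3) ^ a + t) 3^b≡3^a*3^d ⟩
        (+ 3) ^ a + (+ 3) ^ a * (+ 3) ^ d  ≡⟨ factor ((+ 3) ^ a) ((+ 3) ^ d) ⟩
        (+ 3) ^ a * (1ℤ + (+ 3) ^ d)       ∎) p∣3^a+3^b))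
        where
        factor : ∀ x t → x + x * t ≡ x * (1ℤ + t)
        factor = solve-∀

  short-period : ∀ {p} → Prime p → 3 ℕ.< p → ∃[ R ] 1 ℕ.≤ R × R ℕ.< p × IsPeriod p R
  short-period pp 3<p with 3^2d≡1-for-small-d pp 3<p
  ... | d , 1≤d , 2d<p , p∣3^2d-1 = 2 ℕ.* d , ℕ.≤-trans 1≤d (ℕ.m≤m+n d _) , 2d<p ,
    3^2d≡1⇒IsPeriod d pp (ℕ.<-trans (ℕ.n<1+n 2) 3<p) p∣3^2d-1

  -- x s is determined modulo pP by its class and by the quotient (x s - y (cls s)) / p taken modulo P.
  incongruent-family-bound : ∀ p P .{{_ : ℕ.NonZero P}} {N C}
    (x : Fin N → ℤ) (cls : Fin N → Fin C) (y : Fin C → ℤ) →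
    (∀ s → Congr p (x s) (y (cls s))) →
    (∀ s t → Congr (p ℕ.* P) (x s) (x t) → s ≡ t) →
    N ℕ.≤ C ℕ.* P
  incongruent-family-bound p P {N} {C} x cls y x≡y injective = ℕ.≮⇒≥ λ CP<N →
    let s , t , s<t , code-eq = Fin.pigeonhole CP<N code
        cls-eq , digit-eq = Fin.combine-injective (cls s) (digit s) (cls t) (digit t) code-eq
    in Fin.<-irrefl (injective s t (same-code⇒≡ s t cls-eq digit-eq)) s<t
    where
    p∣x-y : ∀ s → + p ∣ x s - y (cls s)
    p∣x-y s = ∣ᵤ⇒∣ (x≡y s)
    k : Fin N → ℤ
    k s = quotient (p∣x-y s)
    digit : Fin N → Fin P
    digit s = fromℕ< (n%ℕd<d (k s) P)
    code : Fin N → Fin (C ℕ.* P)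
    code s = combine (cls s) (digit s)
    same-code⇒≡ : ∀ s t → cls s ≡ cls t → digit s ≡ digit t → Congr (p ℕ.* P) (x s) (x t)
    same-code⇒≡ s t cls-eq digit-eq with %ℕ≡⇒∣- P (k s) (k t)
      (trans (sym (Fin.toℕ-fromℕ< _)) (trans (cong toℕ digit-eq) (Fin.toℕ-fromℕ< _)))
    ... | divides m ks-kt≡mP = ∣⇒∣ᵤ (divides m (begin
      x s - x t                              ≡⟨ insert (x s) (x t) (y (cls s)) ⟩
      (x s - y (cls s)) - (x t - y (cls s))  ≡⟨ cong₂ _-_ (_∣_.equality (p∣x-y s)) x[t]-y[s]≡k[t]p ⟩
      k s * + p - k t * + p                  ≡⟨ distrib (k s) (k t) (+ p) ⟨
      (k s - k t) * + p                      ≡⟨ cong (_* + p) ks-kt≡mP ⟩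
      m * + P * + p                          ≡⟨ regroup m (+ P) (+ p) ⟩
      m * (+ p * + P)                        ≡⟨ cong (m *_) (pos-* p P) ⟨
      m * + (p ℕ.* P)                        ∎))
      where
      open ≡-Reasoning
      x[t]-y[s]≡k[t]p : x t - y (cls s) ≡ k t * + p
      x[t]-y[s]≡k[t]p = trans (cong (λ c → x t - y c) cls-eq) (_∣_.equality (p∣x-y t))
      insert : ∀ a b c → a - b ≡ (a - c) - (b - c)
      insert = solve-∀
      distrib : ∀ a b c → (a - b) * c ≡ a * c - b * c
      distrib = solve-∀
      regroup : ∀ a b c → a * b * c ≡ a * (c * b)
      regroup = solve-∀

open Congruences
open import Data.Nat
open import Data.Nat.Properties
open import Data.Nat.DivMod using (m≡m%n+[m/n]*n; m%n<n; [m+kn]%n≡m%n; m<n⇒m%n≡m)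
open import Data.Nat.Divisibility using (n∣m*n; _∣?_; ∣1⇒≡1)
open import Data.Nat.Tactic.RingSolver using (solve-∀)
open import Data.Integer using (∣_∣; _-_)
open import Relation.Nullary.Decidable using (_×-dec_)

Incong⇒≡ : ∀ {m n i j} → Incong m n → 1 ≤ i → i ≤ n → 1 ≤ j → j ≤ n → Congr m (u i) (u j) → i ≡ j
Incong⇒≡ {m} {i = i} {j} incong 1≤i i≤n 1≤j j≤n c with <-cmp i j
... | tri< i<j _ _ = contradiction c (incong i j 1≤i i<j j≤n)
... | tri≈ _ i≡j _ = i≡j
... | tri> _ _ j<i = contradiction (Congr-sym m (u i) (u j) c) (incong j i 1≤j j<i i≤n)

≡⇒Incong : ∀ {m n} → (∀ {i j} → 1 ≤ i → i ≤ n → 1 ≤ j → j ≤ n → Congr m (u i) (u j) → i ≡ j) →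
           Incong m n
≡⇒Incong injective i j 1≤i i<j j≤n c =
  <-irrefl (injective 1≤i (≤-trans (<⇒≤ i<j) j≤n) (≤-trans 1≤i (<⇒≤ i<j)) j≤n c) i<j

Incong-mono : ∀ {m n n′} → n ≤ n′ → Incong m n′ → Incong m n
Incong-mono n≤n′ incong i j 1≤i i<j j≤n = incong i j 1≤i i<j (≤-trans j≤n n≤n′)

data Halves (K : ℕ) : ℕ → Set where
  lower : ∀ {x} → x ≤ K → Halves K x
  upper : ∀ {x} → 1 ≤ x → x ≤ K → Halves K (x + K)

halves : ∀ K x → x ≤ 2 * K → Halves K x
halves K x x≤2K with x ≤? K
... | yes x≤K = lower x≤K
... | no  x≰K = subst (Halves K) (m∸n+n≡m (<⇒≤ K<x)) (upper (m<n⇒0<n∸m K<x) x∸K≤K)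
  where
  K<x = ≰⇒> x≰K
  x∸K≤K : x ∸ K ≤ K
  x∸K≤K = subst (x ∸ K ≤_) (m+n∸m≡n K K) (∸-monoˡ-≤ K (subst (x ≤_) (cong (K +_) (+-identityʳ K)) x≤2K))

u-injective-mod-2K : ∀ K →
  (∀ {i j} → 1 ≤ i → i ≤ K → 1 ≤ j → j ≤ K → Congr K (u i) (u j) → i ≡ j) →
  (∀ x → Congr K (u (x + K)) (u x)) →
  (∀ x → ¬ Congr (2 * K) (u (x + K)) (u x)) →
  ∀ {i j} → 1 ≤ i → i ≤ 2 * K → 1 ≤ j → j ≤ 2 * K → Congr (2 * K) (u i) (u j) → i ≡ j
u-injective-mod-2K K injective shift ¬shift 1≤i i≤2K 1≤j j≤2K =
  fold (halves K _ i≤2K) (halves K _ j≤2K) 1≤i 1≤j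
  where
  weaken : ∀ a b → Congr (2 * K) a b → Congr K a b
  weaken a b = Congr-weaken a b (n∣m*n 2)
  unshift : ∀ a b → Congr K (u (a + K)) b → Congr K (u a) b
  unshift a b = Congr-trans K (u a) (u (a + K)) b (Congr-sym K (u (a + K)) (u a) (shift a))
  fold : ∀ {i j} → Halves K i → Halves K j → 1 ≤ i → 1 ≤ j → Congr (2 * K) (u i) (u j) → i ≡ j
  fold {i} {j} (lower i≤K) (lower j≤K) 1≤i 1≤j c = injective 1≤i i≤K 1≤j j≤K (weaken (u i) (u j) c)
  fold (upper {i′} 1≤i′ i′≤K) (upper {j′} 1≤j′ j′≤K) _ _ c =
    cong (_+ K) (injective 1≤i′ i′≤K 1≤j′ j′≤K (unshift i′ (u j′) (Congr-sym K (u j′) (u (i′ + K))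
      (unshift j′ (u (i′ + K)) (Congr-sym K (u (i′ + K)) (u (j′ + K)) (weaken (u (i′ + K)) (u (j′ + K)) c))))))
  fold {i} (lower i≤K) (upper {j′} 1≤j′ j′≤K) 1≤i _ c = contradiction (Congr-sym (2 * K) (u j′) (u (j′ + K))
    (subst (λ x → Congr (2 * K) (u x) (u (j′ + K))) i≡j′ c)) (¬shift j′)
    where
    i≡j′ : i ≡ j′
    i≡j′ = injective 1≤i i≤K 1≤j′ j′≤K (Congr-sym K (u j′) (u i)
      (unshift j′ (u i) (Congr-sym K (u i) (u (j′ + K)) (weaken (u i) (u (j′ + K)) c))))
  fold {j = j} (upper {i′} 1≤i′ i′≤K) (lower j≤K) _ 1≤j c =
    contradiction (subst (λ x → Congr (2 * K) (u (x + K)) (u j)) i′≡j c) (¬shift j)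
    where
    i′≡j : i′ ≡ j
    i′≡j = injective 1≤i′ i′≤K 1≤j j≤K (unshift i′ (u j) (weaken (u (i′ + K)) (u j) c))

u-injective-mod-2^k : ∀ k {i j} → 1 ≤ i → i ≤ 2 ^ k → 1 ≤ j → j ≤ 2 ^ k →
                      Congr (2 ^ k) (u i) (u j) → i ≡ j
u-injective-mod-2^k zero    1≤i i≤1 1≤j j≤1 _ = ≤-antisym (≤-trans i≤1 1≤j) (≤-trans j≤1 1≤i)
u-injective-mod-2^k (suc k) = u-injective-mod-2K (2 ^ k) (u-injective-mod-2^k k)
  (u[j+2^k]≡u[j][mod2^k] k) (u[j+2^k]≢u[j][mod2^[1+k]] k)

Incong-2^k : ∀ k → Incong (2 ^ k) (2 ^ k)
Incong-2^k k = ≡⇒Incong (u-injective-mod-2^k k)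

2^k≤1+n<2^[1+k] : ∀ n → ∃[ k ] 2 ^ k ≤ suc n × suc n < 2 ^ suc k
2^k≤1+n<2^[1+k] zero = 0 , ≤-refl , s≤s (s≤s z≤n)
2^k≤1+n<2^[1+k] (suc n) with 2^k≤1+n<2^[1+k] n
... | k , lo , hi with 2 + n <? 2 ^ suc k
...   | yes lt = k , ≤-trans lo (n≤1+n _) , lt
...   | no ¬lt = suc k , ≤-reflexive (sym 2+n≡2^[1+k]) ,
  subst (_< 2 ^ suc (suc k)) (sym 2+n≡2^[1+k]) (^-monoʳ-< 2 ≤-refl (n<1+n (suc k)))
  where
  2+n≡2^[1+k] : 2 + n ≡ 2 ^ suc k
  2+n≡2^[1+k] = ≤-antisym hi (≮⇒≥ ¬lt)

minimal-modulus<2n : ∀ {M n} → 2 ≤ M → (∀ m′ → 1 ≤ m′ → m′ < M → ¬ Incong m′ n) → M < 2 * n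
minimal-modulus<2n {suc (suc M)} {n} (s≤s (s≤s z≤n)) minimal with 2^k≤1+n<2^[1+k] M
... | k , lo , hi with n ≤? 2 ^ k
...   | yes n≤2^k = contradiction (Incong-mono n≤2^k (Incong-2^k k)) (minimal (2 ^ k) (m^n>0 2 k) (s≤s lo))
...   | no  n≰2^k = ≤-<-trans hi (*-monoʳ-< 2 (≰⇒> n≰2^k))

ι-collision : ∀ {m i} → IsIota m i → ∃[ a ] 1 ≤ a × a ≤ i × Congr m (u a) (u (suc i))
ι-collision {m} {i} (incong , maximal) with anyUpTo? (λ a → 1 ≤? a ×-dec m ∣? ∣ (u a - u (suc i)) ∣) (suc i)
... | yes (a , a<1+i , 1≤a , c) = a , 1≤a , s≤s⁻¹ a<1+i , c
... | no none = contradiction extended (maximal (suc i) (n<1+n i))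
  where
  extended : Incong m (suc i)
  extended x y 1≤x x<y y≤1+i with m≤n⇒m<n∨m≡n y≤1+i
  ... | inj₁ y<1+i = incong x y 1≤x x<y (s≤s⁻¹ y<1+i)
  ... | inj₂ refl  = λ c → none (x , x<y , 1≤x , c)

IsPeriod⇒u[x+tR]≡u[x] : ∀ {p R} → IsPeriod p R → ∀ x t → 1 ≤ x → Congr p (u (x + t * R)) (u x)
IsPeriod⇒u[x+tR]≡u[x] {p} {R} period x zero    _   rewrite +-identityʳ x = Congr-refl p (u x)
IsPeriod⇒u[x+tR]≡u[x] {p} {R} period x (suc t) 1≤x = subst (λ i → Congr p (u i) (u x)) x+tR+R≡x+[R+tR]
  (Congr-trans p (u (x + t * R + R)) (u (x + t * R)) (u x)
    (Congr-sym p (u (x + t * R)) (u (x + t * R + R)) (period (x + t * R) (≤-trans 1≤x (m≤m+n x _))))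
    (IsPeriod⇒u[x+tR]≡u[x] period x t 1≤x))
  where
  x+tR+R≡x+[R+tR] : x + t * R + R ≡ x + (R + t * R)
  x+tR+R≡x+[R+tR] = trans (+-assoc x (t * R) R) (cong (x +_) (+-comm (t * R) R))

m+kn≡m′+k′n⇒ : ∀ {m m′ k k′ n} .{{_ : NonZero n}} → m < n → m′ < n →
               m + k * n ≡ m′ + k′ * n → m ≡ m′ × k ≡ k′
m+kn≡m′+k′n⇒ {m} {m′} {k} {k′} {n} m<n m′<n eq =
  m≡m′ , *-cancelʳ-≡ k k′ n (+-cancelˡ-≡ m _ _ (trans eq (cong (_+ k′ * n) (sym m≡m′))))
  where
  open ≡-Reasoning
  m≡m′ : m ≡ m′
  m≡m′ = begin
    m                  ≡⟨ m<n⇒m%n≡m m<n ⟨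
    m % n              ≡⟨ [m+kn]%n≡m%n m k n ⟨
    (m + k * n) % n    ≡⟨ cong (_% n) eq ⟩
    (m′ + k′ * n) % n  ≡⟨ [m+kn]%n≡m%n m′ k′ n ⟩
    m′ % n             ≡⟨ m<n⇒m%n≡m m′<n ⟩
    m′                 ∎

Incong⇒n≤R*P : ∀ {p P n R} .{{_ : NonZero P}} .{{_ : NonZero R}} → IsPeriod p R → Incong (p * P) n → n ≤ R * P
Incong⇒n≤R*P {p} {P} {n} {R} period incong =
  incongruent-family-bound p P (u ∘ suc ∘ toℕ) residue (u ∘ suc ∘ toℕ) same-residue injective
  where
  residue : Fin n → Fin R
  residue s = fromℕ< (m%n<n (toℕ s) R)
  same-residue : ∀ s → Congr p (u (suc (toℕ s))) (u (suc (toℕ (residue s))))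
  same-residue s = subst₂ (λ i j → Congr p (u i) (u (suc j)))
    (cong suc (sym (m≡m%n+[m/n]*n (toℕ s) R))) (sym (Fin.toℕ-fromℕ< (m%n<n (toℕ s) R)))
    (IsPeriod⇒u[x+tR]≡u[x] period (suc (toℕ s % R)) (toℕ s / R) (s≤s z≤n))
  injective : ∀ s t → Congr (p * P) (u (suc (toℕ s))) (u (suc (toℕ t))) → s ≡ t
  injective s t c =
    Fin.toℕ-injective (suc-injective (Incong⇒≡ incong (s≤s z≤n) (Fin.toℕ<n s) (s≤s z≤n) (Fin.toℕ<n t) c))

Incong⇒2Q≤P : ∀ {p P n R a b} Q .{{_ : NonZero P}} → IsPeriod p R → 1 ≤ a → a < b → b ≤ R →
              Congr p (u a) (u b) → Q * R ≤ n → Incong (p * P) n → 2 * Q ≤ P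
Incong⇒2Q≤P {p} {P} {n} {R} {suc a} {suc b} Q period _ a<b b≤R ua≡ub QR≤n incong =
  subst (2 * Q ≤_) (*-identityˡ P)
    (incongruent-family-bound p P {C = 1} (u ∘ index) (λ _ → 0F) (λ _ → u (suc a))
      (≡ua ∘ remQuot {2} Q) injective)
  where
  instance
    R≢0 : NonZero R
    R≢0 = >-nonZero (≤-trans (s≤s z≤n) b≤R)
  start : Fin 2 → ℕ
  start 0F = a
  start 1F = b
  start<R : ∀ ε → start ε < R
  start<R 0F = <-trans (s≤s⁻¹ a<b) b≤R
  start<R 1F = b≤R
  start-injective : ∀ ε ε′ → start ε ≡ start ε′ → ε ≡ ε′
  start-injective 0F 0F _   = refl
  start-injective 1F 1F _   = refl
  start-injective 0F 1F a≡b = contradiction a≡b (<⇒≢ (s≤s⁻¹ a<b))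
  start-injective 1F 0F b≡a = contradiction (sym b≡a) (<⇒≢ (s≤s⁻¹ a<b))
  position : Fin 2 × Fin Q → ℕ
  position (ε , t) = suc (start ε + toℕ t * R)
  position≤n : ∀ x → position x ≤ n
  position≤n (ε , t) =
    ≤-trans (+-monoˡ-≤ (toℕ t * R) (start<R ε)) (≤-trans (*-monoˡ-≤ R (Fin.toℕ<n t)) QR≤n)
  position-injective : ∀ x y → position x ≡ position y → x ≡ y
  position-injective (ε , t) (ε′ , t′) eq with m+kn≡m′+k′n⇒ (start<R ε) (start<R ε′) (suc-injective eq)
  ... | start-eq , t-eq = cong₂ _,_ (start-injective ε ε′ start-eq) (Fin.toℕ-injective t-eq)
  ≡ua : ∀ x → Congr p (u (position x)) (u (suc a))
  ≡ua (0F , t) = IsPeriod⇒u[x+tR]≡u[x] period (suc a) (toℕ t) (s≤s z≤n)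
  ≡ua (1F , t) = Congr-trans p (u (suc b + toℕ t * R)) (u (suc b)) (u (suc a))
    (IsPeriod⇒u[x+tR]≡u[x] period (suc b) (toℕ t) (s≤s z≤n)) (Congr-sym p (u (suc a)) (u (suc b)) ua≡ub)
  index : Fin (2 * Q) → ℕ
  index = position ∘ remQuot {2} Q
  injective : ∀ s t → Congr (p * P) (u (index s)) (u (index t)) → s ≡ t
  injective s t c = begin
    s                                  ≡⟨ Fin.combine-remQuot {2} Q s ⟨
    uncurry combine (remQuot {2} Q s)  ≡⟨ cong (uncurry combine) remQuot-eq ⟩
    uncurry combine (remQuot {2} Q t)  ≡⟨ Fin.combine-remQuot {2} Q t ⟩
    t                                  ∎
    where
    open ≡-Reasoning
    remQuot-eq : remQuot {2} Q s ≡ remQuot {2} Q t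
    remQuot-eq = position-injective (remQuot {2} Q s) (remQuot {2} Q t)
      (Incong⇒≡ incong (s≤s z≤n) (position≤n (remQuot {2} Q s)) (s≤s z≤n) (position≤n (remQuot {2} Q t)) c)

odd⇒odd^ : ∀ {m} → ∃[ h ] m ≡ suc (2 * h) → ∀ e → ∃[ h ] m ^ e ≡ suc (2 * h)
odd⇒odd^ _          zero    = 0 , refl
odd⇒odd^ (a , refl) (suc e) with odd⇒odd^ (a , refl) e
... | b , eq = a + b + 2 * a * b , trans (cong (suc (2 * a) *_) eq) (expand a b)
  where
  expand : ∀ a b → suc (2 * a) * suc (2 * b) ≡ suc (2 * (a + b + 2 * a * b))
  expand = solve-∀

1+P*R<p*P : ∀ {p P R} → R < p → p ≤ P → suc P * R < p * P
1+P*R<p*P {p} {P} {R} R<p p≤P = begin-strict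
  suc P * R  <⟨ +-monoˡ-≤ (P * R) (≤-trans R<p p≤P) ⟩
  P + P * R  ≡⟨ *-suc P R ⟨
  P * suc R  ≤⟨ *-monoʳ-≤ P R<p ⟩
  P * p      ≡⟨ *-comm P p ⟩
  p * P      ∎
  where open ≤-Reasoning

-- Take Q = (P + 1)/2: then QR ≤ n, and Incong⇒2Q≤P would give P + 1 ≤ P.
collision-within-period : ∀ {p P n R a b} → ∃[ h ] P ≡ suc (2 * h) → p ≤ P → R < p → IsPeriod p R →
                          1 ≤ a → a < b → b ≤ R → Congr p (u a) (u b) → p * P < 2 * n → ¬ Incong (p * P) n
collision-within-period {p} {P} {n} {R} (h , refl) p≤P R<p period 1≤a a<b b≤R ua≡ub pP<2n incong =
  <-irrefl refl (subst (_≤ P) (*-suc 2 h) (Incong⇒2Q≤P (suc h) period 1≤a a<b b≤R ua≡ub QR≤n incong))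
  where
  QR≤n : suc h * R ≤ n
  QR≤n = <⇒≤ (*-cancelˡ-< 2 _ _ (begin-strict
    2 * (suc h * R)  ≡⟨ *-assoc 2 (suc h) R ⟨
    2 * suc h * R    ≡⟨ cong (_* R) (*-suc 2 h) ⟩
    suc P * R        <⟨ 1+P*R<p*P R<p p≤P ⟩
    p * P            <⟨ pP<2n ⟩
    2 * n            ∎))
    where open ≤-Reasoning

2R≤p⇒¬Incong : ∀ {p P n R} .{{_ : NonZero P}} .{{_ : NonZero R}} → IsPeriod p R → 2 * R ≤ p →
               p * P < 2 * n → ¬ Incong (p * P) n
2R≤p⇒¬Incong {p} {P} {n} {R} period 2R≤p pP<2n incong = <-irrefl refl (begin-strict
  p * P        <⟨ pP<2n ⟩
  2 * n        ≤⟨ *-monoʳ-≤ 2 (Incong⇒n≤R*P {p} {P} {n} {R} period incong) ⟩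
  2 * (R * P)  ≡⟨ *-assoc 2 R P ⟨
  2 * R * P    ≤⟨ *-monoˡ-≤ P 2R≤p ⟩
  p * P        ∎)
  where open ≤-Reasoning

Incong-2 : ∀ {m} → 2 ≤ m → Incong m 2
Incong-2 {m} 2≤m i j 1≤i i<j j≤2 c =
  contradiction (∣1⇒≡1 (subst₂ (λ i j → Congr m (u i) (u j)) i≡1 j≡2 c)) (>⇒≢ 2≤m)
  where
  i≡1 : i ≡ 1
  i≡1 = ≤-antisym (s≤s⁻¹ (≤-trans i<j j≤2)) 1≤i
  j≡2 : j ≡ 2
  j≡2 = ≤-antisym j≤2 (≤-trans (s≤s 1≤i) i<j)

SalajanValue⇒M<2n : ∀ {M} → 2 ≤ M → SalajanValue M → ∃[ n ] Incong M n × M < 2 * n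
SalajanValue⇒M<2n 2≤M (n , _ , _ , incong , minimal) = n , incong , minimal-modulus<2n 2≤M minimal

prime⇒2≤p : ∀ {p} → Prime p → 2 ≤ p
prime⇒2≤p {p} pp = nonTrivial⇒n>1 p {{prime⇒nonTrivial pp}}

p≤p^[1+k] : ∀ {p} → 1 ≤ p → ∀ k → p ≤ p ^ suc k
p≤p^[1+k] {p} 1≤p k = m≤m*n p (p ^ k) {{m^n≢0 p k {{>-nonZero 1≤p}}}}

2≤p^[1+k] : ∀ {p} → 2 ≤ p → ∀ k → 2 ≤ p ^ suc k
2≤p^[1+k] 2≤p k = ≤-trans 2≤p (p≤p^[1+k] (≤-trans (n≤1+n 1) 2≤p) k)

ι<ρ⇒¬SalajanValue : ∀ p → Prime p → 3 < p → ∀ r i → IsRho p r → IsIota p i → i < r →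
                    ∀ e → 2 ≤ e → ¬ SalajanValue (p ^ e)
ι<ρ⇒¬SalajanValue p pp 3<p r i (_ , r-period , r-minimal) ι i<r (suc (suc e)) (s≤s (s≤s z≤n)) salajan =
  let n , incong , pP<2n = SalajanValue⇒M<2n (2≤p^[1+k] (prime⇒2≤p pp) (suc e)) salajan
      R , 1≤R , R<p , R-period = short-period pp 3<p
      a , 1≤a , a≤i , ua≡u[1+i] = ι-collision {p} {i} ι
      r<p = ≤-<-trans (≮⇒≥ λ R<r → r-minimal R 1≤R R<r R-period) R<p
  in collision-within-period {p} {p ^ suc e} {n} {r} {a} {suc i}
       (odd⇒odd^ (odd-prime pp 2<p) (suc e)) (p≤p^[1+k] (<⇒≤ (<-trans (n<1+n 1) 2<p)) e)
       r<p r-period 1≤a (s≤s a≤i) i<r ua≡u[1+i] pP<2n incong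
  where
  2<p = <-trans (n<1+n 2) 3<p

2ι≤p⇒¬SalajanValue : ∀ p → Prime p → ∀ i → IsIota p i → 2 * i ≤ p →
                     ∀ e → 1 ≤ e → ¬ SalajanValue (p ^ e)
2ι≤p⇒¬SalajanValue p pp i ι@(_ , i-maximal) 2i≤p (suc e) (s≤s z≤n) salajan =
  let n , incong , pᵉ<2n = SalajanValue⇒M<2n (2≤p^[1+k] 2≤p e) salajan
  in ¬incong e incong pᵉ<2n
  where
  2≤p = prime⇒2≤p pp
  1≤p = ≤-trans (s≤s z≤n) 2≤p
  n≤i : ∀ {n} → Incong p n → n ≤ i
  n≤i incong = ≮⇒≥ λ i<n → i-maximal _ i<n incong
  3<p : 3 < p
  3<p = ≤-trans (*-monoʳ-≤ 2 (n≤i (Incong-2 2≤p))) 2i≤p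
  ¬incong : ∀ {n} e → Incong (p ^ suc e) n → p ^ suc e < 2 * n → ⊥
  ¬incong {n} zero incong p*1<2n = <-irrefl refl (begin-strict
    p      ≡⟨ *-identityʳ p ⟨
    p * 1  <⟨ p*1<2n ⟩
    2 * n  ≤⟨ *-monoʳ-≤ 2 (n≤i (subst (λ m → Incong m n) (*-identityʳ p) incong)) ⟩
    2 * i  ≤⟨ 2i≤p ⟩
    p      ∎)
    where open ≤-Reasoning
  ¬incong {n} (suc e) incong pP<2n =
    let R , 1≤R , R<p , R-period = short-period pp 3<p
    in case i <? R of λ where
      (yes i<R) →
        let a , 1≤a , a≤i , ua≡u[1+i] = ι-collision {p} {i} ι
        in collision-within-period {p} {p ^ suc e} {n} {R} {a} {suc i}
             (odd⇒odd^ (odd-prime pp (<-trans (n<1+n 2) 3<p)) (suc e)) (p≤p^[1+k] 1≤p e)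
             R<p R-period 1≤a (s≤s a≤i) i<R ua≡u[1+i] pP<2n incong
      (no i≮R) → 2R≤p⇒¬Incong {p} {p ^ suc e} {n} {R} {{m^n≢0 p (suc e) {{>-nonZero 1≤p}}}} {{>-nonZero 1≤R}}
        R-period (≤-trans (*-monoʳ-≤ 2 (≮⇒≥ i≮R)) 2i≤p) pP<2n incong

lemma18 : (∀ p → Prime p → 3 < p → ∀ r i → IsRho p r → IsIota p i → i < r →
             ∀ e → 2 ≤ e → ¬ SalajanValue (p ^ e))
          × (∀ p → Prime p → ∀ i → IsIota p i → 2 * i ≤ p →
             ∀ e → 1 ≤ e → ¬ SalajanValue (p ^ e))
lemma18 = ι<ρ⇒¬SalajanValue , 2ι≤p⇒¬SalajanValue
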